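{- Let $G=(V,E)$ be a graph and let $u,v\in V$ be distinct nodes. Then $u\le_G v$ if and only if for all pairs $(u',v')$ preceding $(u,v)$ it holds $\lambda(u')\,\angle\,\lambda(v')$.
   Context: $\Sigma$ is a finite alphabet with a fixed total order $\preceq$. A graph is $G=(V,E)$ with $V$ finite and $E\subseteq V\times V\times\Sigma$. Let $\#\notin\Sigma$ with $\#\prec a$ for all $a\in\Sigma$. For $v\in V$, $\lambda(v)$ is the set of labels of edges entering $v$ if $v$ has incoming edges, and $\{\#\}$ otherwise. Write $\lambda(u)\,\angle\,\lambda(v)$ iff $a\preceq b$ for all $a\in\lambda(u)$, $b\in\lambda(v)$. A co-lex relation on $G$ is a reflexive $R\subseteq V\times V$ such that (Axiom 1) $u\neq v$, $(u,v)\in R$ implies $\lambda(u)\,\angle\,\lambda(v)$; (Axiom 2) for $(u',u,a),(v',v,a)\in E$ with $u\neq v$ and $(u,v)\in R$, $(u',v')\in R$. $\le_G$ is the maximum co-lex relation (the co-lex relation containing every co-lex relation on $G$; it exists). For pairs of distinct nodes, $(u',v')$ precedes $(u,v)$ if there exist $r\ge1$, nodes $u_1,\dots,u_r,v_1,\dots,v_r$ and letters $a_1,\dots,a_{r-1}$ with $u_1=u'$, $v_1=v'$, $u_r=u$, $v_r=v$, $u_i\neq v_i$ for all $i$, and $(u_i,u_{i+1},a_i),(v_i,v_{i+1},a_i)\in E$ for $i<r$. -}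

module Defs where

open import Level using (0ℓ)
open import Data.Nat using (ℕ)
open import Data.Fin using (Fin)
import Data.Fin as Fin
open import Data.Maybe using (Maybe; just; nothing)
open import Data.Product using (_×_; _,_; ∃; ∃-syntax)
open import Data.List using (List)
open import Data.List.Membership.Propositional using (_∈_)
open import Relation.Nullary using (¬_)
open import Relation.Binary.PropositionalEquality using (_≡_; _≢_)
open import Data.Unit using (⊤)
open import Data.Empty using (⊥)

-- Alphabet Σ = Fin σ, totally ordered by the usual order on Fin.
-- Nodes V = Fin n.  A graph is a finite edge set, given as a list of
-- triples (source , target , label).
record Graph (n σ : ℕ) : Set where
  constructor graph
  field
    edges : List (Fin n × Fin n × Fin σ)

open Graph public

Edge : ∀ {n σ} → Graph n σ → Fin n → Fin n → Fin σ → Set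
Edge G u v a = (u , v , a) ∈ edges G

-- Extended alphabet Σ ∪ {#}: nothing plays the role of #.
Label : ℕ → Set
Label σ = Maybe (Fin σ)

_⪯_ : ∀ {σ} → Label σ → Label σ → Set
nothing ⪯ _ = ⊤
just a ⪯ nothing = ⊥
just a ⪯ just b = a Fin.≤ b

data InLambda {n σ} (G : Graph n σ) (v : Fin n) : Label σ → Set where
  incoming : ∀ {u a} → Edge G u v a → InLambda G v (just a)
  source   : (∀ u a → ¬ Edge G u v a) → InLambda G v nothing

Angle : ∀ {n σ} → Graph n σ → Fin n → Fin n → Set
Angle G u v = ∀ a b → InLambda G u a → InLambda G v b → a ⪯ b

Rel : ℕ → Set₁
Rel n = Fin n → Fin n → Set

record IsColex {n σ} (G : Graph n σ) (R : Rel n) : Set where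
  field
    reflexive : ∀ u → R u u
    axiom1 : ∀ u v → u ≢ v → R u v → Angle G u v
    axiom2 : ∀ u' u v' v a → Edge G u' u a → Edge G v' v a →
             u ≢ v → R u v → R u' v'

record IsMaxColex {n σ} (G : Graph n σ) (R : Rel n) : Set₁ where
  field
    colex : IsColex G R
    maximum : ∀ (R' : Rel n) → IsColex G R' → ∀ u v → R' u v → R u v

-- Precedes G u' v' u v : (u',v') precedes (u,v), i.e. there are paths
-- u'=u_1,…,u_r=u and v'=v_1,…,v_r=v (r ≥ 1) reading the same letters
-- a_1,…,a_{r-1}, with u_i ≢ v_i for all i.
data Precedes {n σ} (G : Graph n σ) : Fin n → Fin n → Fin n → Fin n → Set where
  here : ∀ {u v} → u ≢ v → Precedes G u v u v
  step : ∀ {u' v' x y u v a} → u' ≢ v' → Edge G u' x a → Edge G v' y a →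
         Precedes G x y u v → Precedes G u' v' u v

{-# OPTIONS --safe #-}
module Submission where

-- (⇒) Axiom 2 propagates u ≤G v backwards along every preceding pair, and Axiom 1
-- then gives the angle condition there. (⇐) The relation "equal, or preceding
-- (u,v)" is co-lex exactly when all preceding pairs satisfy the angle condition,
-- so by maximality it is contained in ≤G, and it contains (u,v).

open import Defs
open import Data.Fin using (Fin; _≟_)
open import Data.Product using (_×_; _,_)
open import Data.Sum using (_⊎_; inj₁; inj₂)
open import Relation.Nullary using (yes; no)
open import Relation.Nullary.Negation using (contradiction)
open import Relation.Binary.PropositionalEquality using (_≢_; _≡_; refl)

module _ {n σ} {G : Graph n σ} where

  Precedes⇒≢ : ∀ {u' v' u v} → Precedes G u' v' u v → u' ≢ v'
  Precedes⇒≢ (here u≢v)         = u≢v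
  Precedes⇒≢ (step u'≢v' _ _ _) = u'≢v'

  colex-backward : ∀ {R} → IsColex G R →
                   ∀ {u' v' u v} → Precedes G u' v' u v → R u v → R u' v'
  colex-backward R-colex (here _) uRv = uRv
  colex-backward R-colex (step _ e₁ e₂ p) uRv =
    IsColex.axiom2 R-colex _ _ _ _ _ e₁ e₂ (Precedes⇒≢ p) (colex-backward R-colex p uRv)

  colex⇒precedes-angle : ∀ {R} → IsColex G R →
                         ∀ {u v} → R u v → ∀ u' v' → Precedes G u' v' u v → Angle G u' v'
  colex⇒precedes-angle R-colex uRv u' v' p =
    IsColex.axiom1 R-colex u' v' (Precedes⇒≢ p) (colex-backward R-colex p uRv)

  EqOrPrecedes : Fin n → Fin n → Rel n
  EqOrPrecedes u v u' v' = u' ≡ v' ⊎ Precedes G u' v' u v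

  EqOrPrecedes-step : ∀ {u v u' v' x y a} → Edge G u' x a → Edge G v' y a →
                      Precedes G x y u v → EqOrPrecedes u v u' v'
  EqOrPrecedes-step {u' = u'} {v'} e₁ e₂ p with u' ≟ v'
  ... | yes u'≡v' = inj₁ u'≡v'
  ... | no  u'≢v' = inj₂ (step u'≢v' e₁ e₂ p)

  EqOrPrecedes-colex : ∀ {u v} → (∀ u' v' → Precedes G u' v' u v → Angle G u' v') →
                       IsColex G (EqOrPrecedes u v)
  EqOrPrecedes-colex angle = record
    { reflexive = λ _ → inj₁ refl
    ; axiom1    = λ { _ _ x≢y (inj₁ x≡y) → contradiction x≡y x≢y
                    ; x y _   (inj₂ p)   → angle x y p }
    ; axiom2    = λ { _ _ _ _ _ _  _  x≢y (inj₁ x≡y) → contradiction x≡y x≢y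
                    ; _ _ _ _ _ e₁ e₂ _   (inj₂ p)   → EqOrPrecedes-step e₁ e₂ p }
    }

corollary1 : ∀ {n σ} (G : Graph n σ) (≤G : Rel n) → IsMaxColex G ≤G →
    ∀ (u v : Fin n) → u ≢ v →
    (≤G u v → ∀ u' v' → Precedes G u' v' u v → Angle G u' v') ×
    ((∀ u' v' → Precedes G u' v' u v → Angle G u' v') → ≤G u v)
corollary1 G ≤G max u v u≢v =
  colex⇒precedes-angle colex ,
  λ angle → maximum (EqOrPrecedes u v) (EqOrPrecedes-colex angle) u v (inj₂ (here u≢v))
  where open IsMaxColex max
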